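{- Let $G$ be a connected graph and let $x$ be a vertex of $G$. If $x$ belongs to some general position set of $G$ of cardinality ${\rm gp}(G)$, then ${\rm gp}(G)-1\le {\rm gp}(G-x)$.
   Context: All graphs are simple. A set $X\subseteq V(G)$ is a general position set of $G$ if for every pair of distinct $u,v\in X$ and every shortest $u,v$-path $P$ in $G$ we have $V(P)\cap X=\{u,v\}$ (vertices in different components impose no condition). ${\rm gp}(G)$ is the maximum cardinality of a general position set of $G$. $G-x$ is the subgraph induced by $V(G)\setminus\{x\}$. -}

module Defs where

open import Data.Nat using (ℕ; zero; suc; _≤_)
open import Data.Fin using (Fin; punchIn)
open import Data.Fin.Subset using (Subset; _∈_; ∣_∣)
open import Data.Sum using (_⊎_)
open import Data.Product using (Σ; _×_; ∃)
open import Relation.Binary.PropositionalEquality using (_≡_)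
open import Relation.Nullary using (¬_)
open import Level using (0ℓ) renaming (suc to lsuc)

record Graph (n : ℕ) : Set₁ where
  field
    Adj    : Fin n → Fin n → Set
    sym    : ∀ {u v} → Adj u v → Adj v u
    irrefl : ∀ {u} → ¬ Adj u u

module _ {n : ℕ} (G : Graph n) where
  open Graph G

  data Walk : Fin n → Fin n → Set where
    [_]  : (u : Fin n) → Walk u u
    _∷_  : ∀ {u w v} → Adj u w → Walk w v → Walk u v

  len : ∀ {u v} → Walk u v → ℕ
  len [ _ ]    = zero
  len (_ ∷ p) = suc (len p)

  data OnWalk (w : Fin n) : ∀ {u v} → Walk u v → Set where
    here-end : OnWalk w [ w ]
    here     : ∀ {v w'} (a : Adj w w') (p : Walk w' v) → OnWalk w (a ∷ p)
    there    : ∀ {u w' v} (a : Adj u w') {p : Walk w' v} → OnWalk w p → OnWalk w (a ∷ p)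

  -- a shortest u,v-path: a u,v-walk of minimum length (such a walk is a path)
  Shortest : ∀ {u v} → Walk u v → Set
  Shortest {u} {v} p = ∀ (q : Walk u v) → len p ≤ len q

  Connected : Set
  Connected = ∀ u v → Walk u v

  GeneralPosition : Subset n → Set
  GeneralPosition X =
    ∀ u v → u ∈ X → v ∈ X → ¬ u ≡ v →
    ∀ (P : Walk u v) → Shortest P →
    ∀ w → OnWalk w P → w ∈ X → (w ≡ u ⊎ w ≡ v)

  IsGP : ℕ → Set
  IsGP k = (Σ (Subset n) λ X → GeneralPosition X × ∣ X ∣ ≡ k)
         × (∀ X → GeneralPosition X → ∣ X ∣ ≤ k)

-- G - x : the subgraph induced by V(G) ∖ {x}; Fin m is embedded into
-- Fin (suc m) ∖ {x} via punchIn x.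
_-ᵥ_ : ∀ {m} → Graph (suc m) → Fin (suc m) → Graph m
G -ᵥ x = record
  { Adj    = λ i j → Adj (punchIn x i) (punchIn x j)
  ; sym    = sym
  ; irrefl = irrefl
  }
  where open Graph G

{-# OPTIONS --safe #-}
-- If X is a general position set of G containing x, then X ∖ {x} is a general
-- position set of G - x.  The point is that deleting x does not change the
-- distance between two vertices u, v of X ∖ {x}: a shortest u,v-path of G
-- cannot pass through x ∈ X, so it survives in G - x.  Hence every shortest
-- u,v-path of G - x is also shortest in G, and the general position condition
-- of X applies to it.
module Submission where

open import Defs
open import Data.Nat using (ℕ; suc; _≤_; _<_; _∸_; _≤?_)
open import Data.Nat.Induction using (<-wellFounded)
open import Data.Nat.Properties using (≤-refl; ≤-trans; <⇒≤; ≮⇒≥; module ≤-Reasoning)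
open import Data.Fin using (Fin; zero; suc; punchIn)
open import Data.Fin.Properties using (punchIn-injective; punchInᵢ≢i; punchIn-punchOut)
open import Data.Fin.Subset using (Subset; _∈_; ∣_∣; inside; outside)
open import Data.Vec using (_∷_; removeAt; here; there)
open import Data.Product using (Σ; _×_; _,_)
import Data.Sum as Sum
open import Function using (_∘_)
open import Induction.WellFounded using (Acc; acc)
open import Relation.Binary.PropositionalEquality using (_≡_; refl; sym; cong; subst)
open import Relation.Nullary using (¬_; yes; no)
open import Relation.Nullary.Decidable using (decidable-stable; ¬¬-excluded-middle)
open import Relation.Nullary.Negation using (¬¬-map)

x∈p⇒∣p∣≡suc∣removeAt∣ : ∀ {n} (p : Subset (suc n)) {x} → x ∈ p →
                         ∣ p ∣ ≡ suc ∣ removeAt p x ∣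
x∈p⇒∣p∣≡suc∣removeAt∣ (inside ∷ _)                        here        = refl
x∈p⇒∣p∣≡suc∣removeAt∣ (inside ∷ q@(_ ∷ _))  {suc _} (there x∈q) =
  cong suc (x∈p⇒∣p∣≡suc∣removeAt∣ q x∈q)
x∈p⇒∣p∣≡suc∣removeAt∣ (outside ∷ q@(_ ∷ _)) {suc _} (there x∈q) =
  x∈p⇒∣p∣≡suc∣removeAt∣ q x∈q

∈removeAt⇒punchIn∈ : ∀ {n} (p : Subset (suc n)) i {j} → j ∈ removeAt p i → punchIn i j ∈ p
∈removeAt⇒punchIn∈ (_ ∷ _)         zero            j∈q         = there j∈q
∈removeAt⇒punchIn∈ (_ ∷ _ ∷ _)     (suc _) {zero}  here        = here
∈removeAt⇒punchIn∈ (_ ∷ q@(_ ∷ _)) (suc i) {suc j} (there j∈q) = there (∈removeAt⇒punchIn∈ q i j∈q)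

module _ {n} (G : Graph n) where

  onWalk-start : ∀ {u v} (p : Walk G u v) → OnWalk G u p
  onWalk-start [ u ]   = here-end
  onWalk-start (a ∷ p) = here a p

  -- Walks cannot be searched exhaustively, so a shortest walk is only obtained
  -- under double negation; this suffices for the decidable goals it serves.
  ¬¬-shortest-below : ∀ {u v} (q : Walk G u v) →
    ¬ ¬ Σ (Walk G u v) (λ s → Shortest G s × len G s ≤ len G q)
  ¬¬-shortest-below q = go q (<-wellFounded (len G q))
    where
    go : ∀ {u v} (q : Walk G u v) → Acc _<_ (len G q) →
         ¬ ¬ Σ (Walk G u v) (λ s → Shortest G s × len G s ≤ len G q)
    go {u} {v} q (acc rec) ¬below =
      ¬¬-excluded-middle {A = Σ (Walk G u v) λ r → len G r < len G q} λ where
        (yes (r , r<q)) → go r (rec r<q) λ (s , shortest , s≤r) →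
                            ¬below (s , shortest , ≤-trans s≤r (<⇒≤ r<q))
        (no ∄shorter)   → ¬below (q , (λ r → ≮⇒≥ (λ r<q → ∄shorter (r , r<q))) , ≤-refl)

module _ {m} (G : Graph (suc m)) (x : Fin (suc m)) where
  open Graph G using (Adj)

  private
    H : Graph m
    H = G -ᵥ x

  push : ∀ {u v} → Walk H u v → Walk G (punchIn x u) (punchIn x v)
  push [ u ]   = [ punchIn x u ]
  push (a ∷ p) = a ∷ push p

  len-push : ∀ {u v} (p : Walk H u v) → len G (push p) ≡ len H p
  len-push [ _ ]   = refl
  len-push (_ ∷ p) = cong suc (len-push p)

  onWalk-push : ∀ {w u v} (p : Walk H u v) → OnWalk H w p → OnWalk G (punchIn x w) (push p)
  onWalk-push [ _ ]   here-end      = here-end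
  onWalk-push (a ∷ p) (here .a .p)  = here a (push p)
  onWalk-push (a ∷ p) (there .a on) = there a (onWalk-push p on)

  lift : ∀ {a b} (s : Walk G a b) → ¬ OnWalk G x s →
         ∀ {u v} → punchIn x u ≡ a → punchIn x v ≡ b →
         Σ (Walk H u v) λ t → len H t ≡ len G s
  lift [ _ ] _ {u} {v} refl ↑v≡↑u with punchIn-injective x u v (sym ↑v≡↑u)
  ... | refl = [ u ] , refl
  lift (_∷_ {w = w} a s) x∉as {u} refl ↑v≡b =
    let x≢w : ¬ x ≡ w
        x≢w = λ { refl → x∉as (there a (onWalk-start G s)) }
        (t , len-t) = lift s (x∉as ∘ there a) (punchIn-punchOut x≢w) ↑v≡b
    in subst (Adj (punchIn x u)) (sym (punchIn-punchOut x≢w)) a ∷ t , cong suc len-t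

  push-shortest : ∀ {u v} →
    (∀ (s : Walk G (punchIn x u) (punchIn x v)) → Shortest G s → ¬ OnWalk G x s) →
    (p : Walk H u v) → Shortest H p → Shortest G (push p)
  push-shortest avoids p p-shortest q =
    decidable-stable (len G (push p) ≤? len G q) (¬¬-map bound (¬¬-shortest-below G q))
    where
    bound : Σ (Walk G _ _) (λ s → Shortest G s × len G s ≤ len G q) → len G (push p) ≤ len G q
    bound (s , s-shortest , s≤q) =
      let (t , len-t) = lift s (avoids s s-shortest) refl refl
      in begin
        len G (push p) ≡⟨ len-push p ⟩
        len H p        ≤⟨ p-shortest t ⟩
        len H t        ≡⟨ len-t ⟩
        len G s        ≤⟨ s≤q ⟩
        len G q        ∎
      where open ≤-Reasoning

  generalPosition-removeAt : ∀ X → GeneralPosition G X → x ∈ X →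
                             GeneralPosition H (removeAt X x)
  generalPosition-removeAt X gp x∈X u v u∈Y v∈Y u≢v p p-shortest w w∈p w∈Y =
    Sum.map (punchIn-injective x w u) (punchIn-injective x w v)
      (gp _ _ u∈X v∈X ↑u≢↑v (push p) (push-shortest avoids p p-shortest)
          (punchIn x w) (onWalk-push p w∈p) (∈removeAt⇒punchIn∈ X x w∈Y))
    where
    u∈X = ∈removeAt⇒punchIn∈ X x u∈Y
    v∈X = ∈removeAt⇒punchIn∈ X x v∈Y
    ↑u≢↑v = u≢v ∘ punchIn-injective x u v
    avoids : ∀ (s : Walk G (punchIn x u) (punchIn x v)) → Shortest G s → ¬ OnWalk G x s
    avoids s s-shortest x∈s =
      Sum.[ punchInᵢ≢i x u ∘ sym , punchInᵢ≢i x v ∘ sym ] (gp _ _ u∈X v∈X ↑u≢↑v s s-shortest x x∈s x∈X)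

proposition3p3 : ∀ {m} (G : Graph (suc m)) (x : Fin (suc m)) (k l : ℕ) →
    Connected G → IsGP G k → IsGP (G -ᵥ x) l →
    Σ (Subset (suc m)) (λ X → GeneralPosition G X × ∣ X ∣ ≡ k × x ∈ X) →
    k ∸ 1 ≤ l
proposition3p3 G x k l _ _ (_ , maximal) (X , gp , refl , x∈X)
  rewrite x∈p⇒∣p∣≡suc∣removeAt∣ X x∈X =
  maximal (removeAt X x) (generalPosition-removeAt G x X gp x∈X)
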